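{- For every positive integer $n$ and every integer $p$: \[ \sum_{j = 0}^{\lfloor n/2 \rfloor} ( - 1)^j \frac{n}{n - j}\binom{n-j}{j}P_{p + n - 3j} = ( - 1)^n (Q_nP_p-P_{n+p} ), \] \[ \sum_{j = 0}^{\lfloor n/2 \rfloor} ( - 1)^j \binom{n-j}{j}P_{p + n - 3j} = ( - 1)^{n - 1}(P_{p+1}P_{n-3}-P_pP_{n-2}), \] \[ \sum_{j = 0}^{\lfloor n/2 \rfloor} ( - 1)^j \frac{n}{n - j}\binom{n-j}{j}P_{p - 4n + 8j} = P_{p + n} Q_{2n} - P_{p + 3n}, \] \[ \sum_{j = 0}^{\lfloor n/2 \rfloor} ( - 1)^j \binom{n-j}{j}P_{p - 4n + 8j} = P_{p+n} P_{2n-2} - P_{p + n - 1}P_{2n-1}, \] \[ \sum_{j = 0}^{\lfloor n/2 \rfloor} ( - 1)^j \frac{n}{n - j}\binom{n-j}{j}P_{p - 3n + 8j} = P_{2n+p} Q_{2n} - P_{p+4n}, \] \[ \sum_{j = 0}^{\lfloor n/2 \rfloor} ( - 1)^j \binom{n-j}{j}P_{p - 3n + 8j} = P_{2n+p} P_{2n-2} - P_{2n+p-1}P_{2n-1}. \]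
   Context: The Padovan numbers $P_n$ are defined for all integers $n$ by $P_0=P_1=P_2=1$ and $P_n=P_{n-2}+P_{n-3}$ for all integers $n$ (extended to negative indices via $P_n=P_{n+3}-P_{n+1}$). The Perrin numbers $Q_n$ are defined for all integers $n$ by $Q_0=3$, $Q_1=0$, $Q_2=2$ and $Q_n=Q_{n-2}+Q_{n-3}$ for all integers $n$. -}

module Defs where

open import Data.Nat as ℕ using (ℕ; zero; suc; _∸_)
open import Data.Nat.DivMod using (_/_)
open import Data.Nat.Combinatorics using (_C_)
open import Data.Integer using (ℤ; +_; -[1+_]; _+_; _-_; _*_)
open import Data.Product using (_×_; _,_; proj₁)

-- Generic ℤ-indexed sequence satisfying  a(n) = a(n-2) + a(n-3)  for all integers n,
-- determined by the initial triple (a 0, a 1, a 2).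
-- A state (x , y , z) stands for (a k , a (k+1) , a (k+2)).
Triple : Set
Triple = ℤ × ℤ × ℤ

fwd : Triple → Triple
fwd (x , y , z) = (y , z , x + y)

bwd : Triple → Triple
bwd (x , y , z) = (z - x , x , y)

iter : ℕ → (Triple → Triple) → Triple → Triple
iter zero    f t = t
iter (suc n) f t = f (iter n f t)

seq3 : Triple → ℤ → ℤ
seq3 t (+ n)      = proj₁ (iter n fwd t)
seq3 t -[1+ n ]   = proj₁ (iter (suc n) bwd t)

P : ℤ → ℤ
P = seq3 (+ 1 , + 1 , + 1)

Q : ℤ → ℤ
Q = seq3 (+ 3 , + 0 , + 2)

sumTo : ℕ → (ℕ → ℤ) → ℤ
sumTo zero    f = f 0
sumTo (suc m) f = sumTo m f + f (suc m)

sgn : ℕ → ℤ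
sgn zero          = + 1
sgn (suc zero)    = -[1+ 0 ]
sgn (suc (suc j)) = sgn j

-- natural-number division (division by zero returns 0; never used below)
divℕ : ℕ → ℕ → ℕ
divℕ a zero    = 0
divℕ a (suc k) = a / suc k

-- the coefficient  n/(n-j) * binom(n-j, j)  (an integer for 0 ≤ j ≤ ⌊n/2⌋, n ≥ 1;
-- computed as the exact quotient  (n * binom(n-j,j)) / (n-j))
lcoef : ℕ → ℕ → ℤ
lcoef n j = + divℕ (n ℕ.* ((n ∸ j) C j)) (n ∸ j)

bcoef : ℕ → ℕ → ℤ
bcoef n j = + ((n ∸ j) C j)

module Submission where

-- Every left-hand side is a Chebyshev-type sum  Σ_{j ≤ ⌊n/2⌋} (-1)^j c(n,j) f(a n + b j + p)
-- with f = P, coefficients c(n,j) = binom(n-j,j) ("binomial sum") or n/(n-j) binom(n-j,j)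
-- ("Lucas sum"), and (a,b) = (1,-3) (identities 1–2) or (-4,8) (identities 3–6; identities 5–6
-- are 3–4 at p + n).  For an arbitrary f, Pascal's rule gives the recurrence
--   B(n+2,p) = B(n+1,a+p) - B(n,2a+b+p),  and the Lucas sum is  L(n+2,p) = B(n+2,p) - B(n,2a+b+p),
-- so a closed form of B is characterised by two initial values and the recurrence, and the closed
-- form of L then follows from one further identity.
-- The closed forms are 2×2 determinants of Padovan numbers, and the identities they must satisfy
-- are bilinear in P(x+·), P(y+·), Q(y+·), P(x+y+·).  Such an expression solves the Padovan
-- recurrence in x and in y separately, hence is determined by its nine values on {0,1,2}²;
-- each of these identities is therefore checked by evaluation on that grid.

open import Defs
open import Data.Nat as ℕ using (ℕ; zero; suc; _∸_; _≤_; _<_; _≥_; z≤n; s≤s; z<s)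
open import Data.Nat.DivMod using (_/_; m/n≡1+[m∸n]/n; m/n≤m; m*n/n≡m; n/n≡1; /-monoˡ-≤)
open import Data.Nat.Combinatorics using (_C_; nCk+nC[k+1]≡[n+1]C[k+1]; k>n⇒nCk≡0; nC1≡n)
import Data.Nat.Properties as ℕP
import Data.Nat.Tactic.RingSolver as ℕSolver
open import Data.Integer using (ℤ; +_; -[1+_]; _+_; _-_; _*_; -_)
import Data.Integer.Properties as ℤP
open import Data.Integer.Tactic.RingSolver using (solve-∀)
open import Data.Product using (_×_; _,_; proj₁; proj₂)
open import Function using (_∘_)
open import Relation.Binary.PropositionalEquality
open import Relation.Nullary using (yes; no)
open ≡-Reasoning

-- f satisfies the Padovan recurrence at every integer.  A record (rather than a bare Π-type) so
-- that the closure combinators below can infer f from the expected type.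
record Rec (f : ℤ → ℤ) : Set where
  constructor recurrence
  field step : ∀ x → f (x + + 3) ≡ f (x + + 1) + f x
open Rec

-- Every sequence seq3 t of Defs solves the recurrence; for negative arguments each case is the
-- fact that the backward step  a(k-1) = a(k+2) - a(k)  inverts the forward one.
rec-seq3 : ∀ t → Rec (seq3 t)
rec-seq3 t = recurrence (seq3-step t)
  where
  cancel : ∀ a b → b ≡ a + (b - a)
  cancel = solve-∀
  seq3-step : ∀ t x → seq3 t (x + + 3) ≡ seq3 t (x + + 1) + seq3 t x
  seq3-step t (+ n) = begin
      seq3 t (+ (n ℕ.+ 3))                ≡⟨ cong (seq3 t ∘ +_) (ℕP.+-comm n 3) ⟩
      u + v                               ≡⟨ ℤP.+-comm u v ⟩
      v + u                               ≡⟨ cong (λ k → seq3 t (+ k) + u) (ℕP.+-comm 1 n) ⟩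
      seq3 t (+ (n ℕ.+ 1)) + seq3 t (+ n) ∎
    where
      u = proj₁ (iter n fwd t)
      v = proj₁ (proj₂ (iter n fwd t))
  seq3-step t x@(-[1+ 0 ])                 = cancel (seq3 t (x + + 1)) _
  seq3-step t x@(-[1+ 1 ])                 = cancel (seq3 t (x + + 1)) _
  seq3-step t x@(-[1+ 2 ])                 = cancel (seq3 t (x + + 1)) _
  seq3-step t x@(-[1+ suc (suc (suc k)) ]) = cancel (seq3 t (x + + 1)) _

rec-P : Rec P
rec-P = rec-seq3 _

rec-Q : Rec Q
rec-Q = rec-seq3 _

Agree3 : (ℤ → ℤ) → (ℤ → ℤ) → Set
Agree3 f g = f (+ 0) ≡ g (+ 0) × f (+ 1) ≡ g (+ 1) × f (+ 2) ≡ g (+ 2)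

module _ {f g : ℤ → ℤ} (rf : Rec f) (rg : Rec g) where
  private
    Window : ℤ → Set
    Window x = f x ≡ g x × f (x + + 1) ≡ g (x + + 1) × f (x + + 2) ≡ g (x + + 2)

    transport : ∀ {x y} → x ≡ y → f x ≡ g x → f y ≡ g y
    transport refl e = e

    forward : ∀ x → f x ≡ g x → f (x + + 1) ≡ g (x + + 1) → f (x + + 3) ≡ g (x + + 3)
    forward x e₀ e₁ = trans (step rf x) (trans (cong₂ _+_ e₁ e₀) (sym (step rg x)))

    backward : ∀ x → f (x + + 1) ≡ g (x + + 1) → f (x + + 3) ≡ g (x + + 3) → f x ≡ g x
    backward x e₁ e₃ = begin
      f x                         ≡⟨ isolate (step rf x) ⟩
      f (x + + 3) - f (x + + 1)   ≡⟨ cong₂ _-_ e₃ e₁ ⟩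
      g (x + + 3) - g (x + + 1)   ≡⟨ sym (isolate (step rg x)) ⟩
      g x                         ∎
      where
        isolate : ∀ {a b c} → a ≡ b + c → c ≡ a - b
        isolate {b = b} {c} refl = sym (cancel b c)
          where cancel : ∀ b c → b + c - b ≡ c
                cancel = solve-∀

    up : ∀ x → Window x → Window (x + + 1)
    up x (e₀ , e₁ , e₂) = e₁ , transport (sym (x+1+1 x)) e₂ , transport (sym (x+1+2 x)) (forward x e₀ e₁)
      where x+1+1 : ∀ x → x + + 1 + + 1 ≡ x + + 2
            x+1+1 = solve-∀
            x+1+2 : ∀ x → x + + 1 + + 2 ≡ x + + 3
            x+1+2 = solve-∀

    down : ∀ x → Window x → Window (x - + 1)
    down x (e₀ , e₁ , e₂) =
        backward (x - + 1) (transport (sym (x-1+1 x)) e₀) (transport (sym (x-1+3 x)) e₂)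
      , transport (sym (x-1+1 x)) e₀ , transport (sym (x-1+2 x)) e₁
      where x-1+1 : ∀ x → x - + 1 + + 1 ≡ x
            x-1+1 = solve-∀
            x-1+2 : ∀ x → x - + 1 + + 2 ≡ x + + 1
            x-1+2 = solve-∀
            x-1+3 : ∀ x → x - + 1 + + 3 ≡ x + + 2
            x-1+3 = solve-∀

    windows : Agree3 f g → ∀ x → Window x
    windows w (+ zero)     = w
    windows w (+ suc n)    = subst Window (cong +_ (ℕP.+-comm n 1)) (up (+ n) (windows w (+ n)))
    windows w -[1+ zero ]  = down (+ 0) w
    windows w -[1+ suc n ] =
      subst Window (cong (λ k → -[1+ suc k ]) (ℕP.+-identityʳ n)) (down -[1+ n ] (windows w -[1+ n ]))

  rec-unique : Agree3 f g → ∀ x → f x ≡ g x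
  rec-unique w x = proj₁ (windows w x)

rec-add : ∀ {f g} → Rec f → Rec g → Rec (λ x → f x + g x)
rec-add {f} {g} rf rg = recurrence λ x →
  trans (cong₂ _+_ (step rf x) (step rg x)) (interchange (f (x + + 1)) (f x) (g (x + + 1)) (g x))
  where interchange : ∀ a b c d → a + b + (c + d) ≡ a + c + (b + d)
        interchange = solve-∀

rec-neg : ∀ {f} → Rec f → Rec (λ x → - f x)
rec-neg {f} rf = recurrence λ x → trans (cong -_ (step rf x)) (ℤP.neg-distrib-+ (f (x + + 1)) (f x))

rec-sub : ∀ {f g} → Rec f → Rec g → Rec (λ x → f x - g x)
rec-sub rf rg = rec-add rf (rec-neg rg)

rec-scaleˡ : ∀ {f} c → Rec f → Rec (λ x → c * f x)
rec-scaleˡ {f} c rf = recurrence λ x → trans (cong (c *_) (step rf x)) (ℤP.*-distribˡ-+ c (f (x + + 1)) (f x))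

rec-scaleʳ : ∀ {f} c → Rec f → Rec (λ x → f x * c)
rec-scaleʳ {f} c rf = recurrence λ x → trans (cong (_* c) (step rf x)) (ℤP.*-distribʳ-+ c (f (x + + 1)) (f x))

rec-shiftʳ : ∀ {f} a → Rec f → Rec (λ x → f (x + a))
rec-shiftʳ {f} a rf = recurrence λ x →
  trans (cong f (swap x (+ 3) a)) (trans (step rf (x + a)) (cong (_+ f (x + a)) (cong f (sym (swap x (+ 1) a)))))
  where swap : ∀ x c a → x + c + a ≡ x + a + c
        swap = solve-∀

rec-shiftˡ : ∀ {f} a → Rec f → Rec (λ x → f (a + x))
rec-shiftˡ {f} a rf = recurrence λ x →
  trans (cong f (assoc a x (+ 3))) (trans (step rf (a + x)) (cong (_+ f (a + x)) (cong f (sym (assoc a x (+ 1))))))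
  where assoc : ∀ a x c → a + (x + c) ≡ a + x + c
        assoc = solve-∀

BiRec : (ℤ → ℤ → ℤ) → Set
BiRec F = (∀ y → Rec (λ x → F x y)) × (∀ x → Rec (λ y → F x y))

bi-prod : ∀ {f g} → Rec f → Rec g → BiRec (λ x y → f x * g y)
bi-prod {f} {g} rf rg = (λ y → rec-scaleʳ (g y) rf) , (λ x → rec-scaleˡ (f x) rg)

bi-diag : ∀ {f} → Rec f → BiRec (λ x y → f (y + x))
bi-diag rf = (λ y → rec-shiftˡ y rf) , (λ x → rec-shiftʳ x rf)

bi-shiftˣ : ∀ {F} a → BiRec F → BiRec (λ x y → F (a + x) y)
bi-shiftˣ a (rx , ry) = (λ y → rec-shiftˡ a (rx y)) , (λ x → ry (a + x))

bi-shiftʸ : ∀ {F} b → BiRec F → BiRec (λ x y → F x (b + y))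
bi-shiftʸ b (rx , ry) = (λ y → rx (b + y)) , (λ x → rec-shiftˡ b (ry x))

bi-add : ∀ {F G} → BiRec F → BiRec G → BiRec (λ x y → F x y + G x y)
bi-add (fx , fy) (gx , gy) = (λ y → rec-add (fx y) (gx y)) , (λ x → rec-add (fy x) (gy x))

bi-neg : ∀ {F} → BiRec F → BiRec (λ x y → - F x y)
bi-neg (fx , fy) = (λ y → rec-neg (fx y)) , (λ x → rec-neg (fy x))

bi-sub : ∀ {F G} → BiRec F → BiRec G → BiRec (λ x y → F x y - G x y)
bi-sub bf bg = bi-add bf (bi-neg bg)

Grid : (ℤ → ℤ → ℤ) → (ℤ → ℤ → ℤ) → Set
Grid F G = Agree3 (λ x → F x (+ 0)) (λ x → G x (+ 0))
         × Agree3 (λ x → F x (+ 1)) (λ x → G x (+ 1))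
         × Agree3 (λ x → F x (+ 2)) (λ x → G x (+ 2))

-- Grid principle: two-variable solutions agreeing on the grid are equal.  Uniqueness in x
-- propagates the grid to the three lines y = 0, 1, 2; uniqueness in y then fills the plane.
grid-unique : ∀ {F G} → BiRec F → BiRec G → Grid F G → ∀ x y → F x y ≡ G x y
grid-unique (fx , fy) (gx , gy) (g₀ , g₁ , g₂) x =
  rec-unique (fy x) (gy x)
    (rec-unique (fx (+ 0)) (gx (+ 0)) g₀ x , rec-unique (fx (+ 1)) (gx (+ 1)) g₁ x , rec-unique (fx (+ 2)) (gx (+ 2)) g₂ x)

-- The two Padovan determinants appearing in the closed forms (families (1,-3) and (-4,8)).
detA : ℤ → ℤ → ℤ
detA x y = P (x + + 1) * P (y - + 3) - P x * P (y - + 2)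

detB : ℤ → ℤ → ℤ
detB x y = P x * P (y - + 2) - P (x - + 1) * P (y - + 1)

bi-detA : BiRec detA
bi-detA = bi-sub (bi-prod (rec-shiftʳ (+ 1) rec-P) (rec-shiftʳ (- + 3) rec-P)) (bi-prod rec-P (rec-shiftʳ (- + 2) rec-P))

bi-detB : BiRec detB
bi-detB = bi-sub (bi-prod rec-P (rec-shiftʳ (- + 2) rec-P)) (bi-prod (rec-shiftʳ (- + 1) rec-P) (rec-shiftʳ (- + 1) rec-P))

-- The determinant identities; in each, both sides are two-variable solutions and the nine grid
-- values are compared by evaluation.
-- detA satisfies the sum recurrence of the family (a, b) = (1, -3) (up to the sign (-1)^n) ...
detA-rec : ∀ x y → detA x (+ 2 + y) ≡ - detA (+ 1 + x) (+ 1 + y) - detA (- + 1 + x) y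
detA-rec = grid-unique (bi-shiftʸ (+ 2) bi-detA)
  (bi-sub (bi-neg (bi-shiftˣ (+ 1) (bi-shiftʸ (+ 1) bi-detA))) (bi-shiftˣ (- + 1) bi-detA))
  ((refl , refl , refl) , (refl , refl , refl) , (refl , refl , refl))

-- ... and its Lucas combination is the Perrin expression of identity 1.
detA-lucas : ∀ x y → detA x (+ 2 + y) - detA (- + 1 + x) y ≡ P (+ 2 + y + x) - P x * Q (+ 2 + y)
detA-lucas = grid-unique (bi-sub (bi-shiftʸ (+ 2) bi-detA) (bi-shiftˣ (- + 1) bi-detA))
  (bi-sub (bi-shiftʸ (+ 2) (bi-diag rec-P)) (bi-shiftʸ (+ 2) (bi-prod rec-P rec-Q)))
  ((refl , refl , refl) , (refl , refl , refl) , (refl , refl , refl))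

-- detB satisfies the sum recurrence of the family (a, b) = (-4, 8) ...
detB-rec : ∀ x y → detB (+ 2 + x) (+ 4 + y) ≡ detB (- + 3 + x) (+ 2 + y) - detB x y
detB-rec = grid-unique (bi-shiftˣ (+ 2) (bi-shiftʸ (+ 4) bi-detB))
  (bi-sub (bi-shiftˣ (- + 3) (bi-shiftʸ (+ 2) bi-detB)) bi-detB)
  ((refl , refl , refl) , (refl , refl , refl) , (refl , refl , refl))

-- ... and its Lucas combination is the Perrin expression of identity 3.
detB-lucas : ∀ x y → detB (+ 2 + x) (+ 4 + y) - detB x y ≡ P (+ 2 + x) * Q (+ 4 + y) - P (+ 6 + y + x)
detB-lucas = grid-unique (bi-sub (bi-shiftˣ (+ 2) (bi-shiftʸ (+ 4) bi-detB)) bi-detB)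
  (bi-sub (bi-shiftˣ (+ 2) (bi-shiftʸ (+ 4) (bi-prod rec-P rec-Q))) (bi-shiftʸ (+ 6) (bi-diag rec-P)))
  ((refl , refl , refl) , (refl , refl , refl) , (refl , refl , refl))

sgn-suc : ∀ j → sgn (suc j) ≡ - sgn j
sgn-suc zero          = refl
sgn-suc (suc zero)    = refl
sgn-suc (suc (suc j)) = sgn-suc j

sumTo-cong : ∀ m {g h : ℕ → ℤ} → (∀ j → j ≤ m → g j ≡ h j) → sumTo m g ≡ sumTo m h
sumTo-cong zero    e = e 0 z≤n
sumTo-cong (suc m) e = cong₂ _+_ (sumTo-cong m (λ j j≤m → e j (ℕP.m≤n⇒m≤1+n j≤m))) (e (suc m) ℕP.≤-refl)

sumTo-pad : ∀ {m} M (g : ℕ → ℤ) → (∀ j → m < j → g j ≡ + 0) → m ≤ M → sumTo M g ≡ sumTo m g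
sumTo-pad {m} M g zeros m≤M = trans (cong (λ k → sumTo k g) (sym (ℕP.m∸n+n≡m m≤M))) (pad (M ∸ m))
  where
    pad : ∀ d → sumTo (d ℕ.+ m) g ≡ sumTo m g
    pad zero    = refl
    pad (suc d) = trans (cong (λ s → sumTo (d ℕ.+ m) g + s) (zeros _ (s≤s (ℕP.m≤n+m m d))))
                        (trans (ℤP.+-identityʳ _) (pad d))

sumTo-peel : ∀ m (g₂ g₁ g₀ : ℕ → ℤ) → g₂ 0 ≡ g₁ 0 → (∀ j → j ≤ m → g₂ (suc j) ≡ g₁ (suc j) - g₀ j) →
             sumTo (suc m) g₂ ≡ sumTo (suc m) g₁ - sumTo m g₀
sumTo-peel zero g₂ g₁ g₀ e₀ e = trans (cong₂ _+_ e₀ (e 0 z≤n)) (regroup (g₁ 0) (g₁ 1) (g₀ 0))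
  where regroup : ∀ a b c → a + (b - c) ≡ a + b - c
        regroup = solve-∀
sumTo-peel (suc m) g₂ g₁ g₀ e₀ e =
  trans (cong₂ _+_ (sumTo-peel m g₂ g₁ g₀ e₀ (λ j j≤m → e j (ℕP.m≤n⇒m≤1+n j≤m))) (e (suc m) ℕP.≤-refl))
        (regroup (sumTo (suc m) g₁) (sumTo m g₀) (g₁ (suc (suc m))) (g₀ (suc m)))
  where regroup : ∀ a b c d → a - b + (c - d) ≡ a + c - (b + d)
        regroup = solve-∀

half : ∀ m → suc (suc m) / 2 ≡ suc (m / 2)
half m = m/n≡1+[m∸n]/n {suc (suc m)} {2} (s≤s (s≤s z≤n))

-- Beyond the summation range ⌊n/2⌋ the coefficient binom(n-j, j) vanishes, since n - j < j.
binom-vanish : ∀ n j → n / 2 < j → (n ∸ j) C j ≡ 0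
binom-vanish n (suc j) lt = k>n⇒nCk≡0 (ℕP.m<n+o⇒m∸n<o n (suc j) n<2j)
  where
    double : ∀ k → k ℕ.+ k ≡ k ℕ.* 2
    double = ℕSolver.solve-∀
    n<2j : n < suc j ℕ.+ suc j
    n<2j = ℕP.≰⇒> λ 2j≤n → ℕP.<⇒≱ lt
      (subst (_≤ n / 2) (m*n/n≡m (suc j) 2) (/-monoˡ-≤ 2 (subst (_≤ n) (double (suc j)) 2j≤n)))

-- Pascal's rule in the form needed for binom(n-j, j), valid for all j thanks to truncation.
pascal : ∀ n j → (suc n ∸ j) C suc j ≡ (n ∸ j) C suc j ℕ.+ (n ∸ j) C j
pascal n j with j ℕP.≤? n
... | yes j≤n = begin
      (suc n ∸ j) C suc j              ≡⟨ cong (_C suc j) (ℕP.+-∸-assoc 1 j≤n) ⟩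
      suc (n ∸ j) C suc j              ≡⟨ sym (nCk+nC[k+1]≡[n+1]C[k+1] (n ∸ j) j) ⟩
      (n ∸ j) C j ℕ.+ (n ∸ j) C suc j  ≡⟨ ℕP.+-comm ((n ∸ j) C j) _ ⟩
      (n ∸ j) C suc j ℕ.+ (n ∸ j) C j  ∎
... | no j≰n =
  trans (empty (ℕP.m≤n⇒m∸n≡0 n<j) z<s) (sym (cong₂ ℕ._+_ (empty n∸j≡0 z<s) (empty n∸j≡0 (ℕP.≤-trans z<s n<j))))
  where
    n<j = ℕP.≰⇒> j≰n
    n∸j≡0 : n ∸ j ≡ 0
    n∸j≡0 = ℕP.m≤n⇒m∸n≡0 (ℕP.<⇒≤ n<j)
    empty : ∀ {m k} → m ≡ 0 → 0 < k → m C k ≡ 0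
    empty refl 0<k = k>n⇒nCk≡0 0<k

absorption : ∀ N k → suc k ℕ.* (suc N C suc k) ≡ suc N ℕ.* (N C k)
absorption zero    zero    = refl
absorption zero    (suc k) =
  trans (cong (suc (suc k) ℕ.*_) (k>n⇒nCk≡0 {1} {suc (suc k)} (s≤s (s≤s z≤n)))) (ℕP.*-zeroʳ (suc (suc k)))
absorption (suc N) zero    = trans (ℕP.*-identityˡ _) (trans (nC1≡n (suc (suc N))) (sym (ℕP.*-identityʳ _)))
absorption (suc N) (suc k) = begin
    suc (suc k) ℕ.* (suc (suc N) C suc (suc k))       ≡⟨ cong (suc (suc k) ℕ.*_) (sym (nCk+nC[k+1]≡[n+1]C[k+1] (suc N) (suc k))) ⟩
    suc (suc k) ℕ.* (A ℕ.+ B)                         ≡⟨ spread k A B ⟩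
    A ℕ.+ suc k ℕ.* A ℕ.+ suc (suc k) ℕ.* B           ≡⟨ cong₂ (λ u v → A ℕ.+ u ℕ.+ v) (absorption N k) (absorption N (suc k)) ⟩
    A ℕ.+ suc N ℕ.* (N C k) ℕ.+ suc N ℕ.* (N C suc k) ≡⟨ gather N A (N C k) (N C suc k) ⟩
    A ℕ.+ suc N ℕ.* (N C k ℕ.+ N C suc k)             ≡⟨ cong (λ u → A ℕ.+ suc N ℕ.* u) (nCk+nC[k+1]≡[n+1]C[k+1] N k) ⟩
    suc (suc N) ℕ.* A                                 ∎
  where
    A = suc N C suc k
    B = suc N C suc (suc k)
    spread : ∀ k A B → suc (suc k) ℕ.* (A ℕ.+ B) ≡ A ℕ.+ suc k ℕ.* A ℕ.+ suc (suc k) ℕ.* B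
    spread = ℕSolver.solve-∀
    gather : ∀ N A u v → A ℕ.+ suc N ℕ.* u ℕ.+ suc N ℕ.* v ≡ A ℕ.+ suc N ℕ.* (u ℕ.+ v)
    gather = ℕSolver.solve-∀

bcoef-pascal : ∀ n j → bcoef (suc (suc n)) (suc j) ≡ bcoef (suc n) (suc j) + bcoef n j
bcoef-pascal n j = trans (cong +_ (pascal n j)) (ℤP.pos-+ ((n ∸ j) C suc j) ((n ∸ j) C j))

lcoef-first : ∀ n → lcoef (suc n) 0 ≡ + 1
lcoef-first n = cong +_ (trans (cong (_/ suc n) (ℕP.*-identityʳ (suc n))) (n/n≡1 (suc n)))

lcoef-split : ∀ m j → j ≤ m → lcoef (suc (suc m)) (suc j) ≡ bcoef (suc (suc m)) (suc j) + bcoef m j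
lcoef-split m j j≤m = trans (cong +_ (begin
    divℕ (suc (suc m) ℕ.* ((suc m ∸ j) C suc j)) (suc m ∸ j) ≡⟨ cong (λ K → divℕ (suc (suc m) ℕ.* (K C suc j)) K) e ⟩
    suc (suc m) ℕ.* X / suc N                                ≡⟨ cong (λ t → t ℕ.* X / suc N) size ⟩
    (suc N ℕ.+ suc j) ℕ.* X / suc N                          ≡⟨ cong (_/ suc N) numerator ⟩
    (X ℕ.+ N C j) ℕ.* suc N / suc N                          ≡⟨ m*n/n≡m _ (suc N) ⟩
    X ℕ.+ N C j                                              ≡⟨ cong (λ K → K C suc j ℕ.+ N C j) (sym e) ⟩
    (suc m ∸ j) C suc j ℕ.+ (m ∸ j) C j                      ∎)) (ℤP.pos-+ ((suc m ∸ j) C suc j) ((m ∸ j) C j))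
  where
    N = m ∸ j
    X = suc N C suc j
    e : suc m ∸ j ≡ suc N
    e = ℕP.+-∸-assoc 1 j≤m
    size : suc (suc m) ≡ suc N ℕ.+ suc j
    size = cong suc (sym (trans (ℕP.+-suc N j) (cong suc (ℕP.m∸n+n≡m j≤m))))
    -- (n-j) divides n binom(n-j, j) exactly, with quotient binom(n-j, j) + binom(n-j-1, j-1)
    numerator : (suc N ℕ.+ suc j) ℕ.* X ≡ (X ℕ.+ N C j) ℕ.* suc N
    numerator = begin
      (suc N ℕ.+ suc j) ℕ.* X             ≡⟨ ℕP.*-distribʳ-+ X (suc N) (suc j) ⟩
      suc N ℕ.* X ℕ.+ suc j ℕ.* X         ≡⟨ cong (suc N ℕ.* X ℕ.+_) (absorption N j) ⟩
      suc N ℕ.* X ℕ.+ suc N ℕ.* (N C j)   ≡⟨ sym (ℕP.*-distribˡ-+ (suc N) X (N C j)) ⟩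
      suc N ℕ.* (X ℕ.+ N C j)             ≡⟨ ℕP.*-comm (suc N) _ ⟩
      (X ℕ.+ N C j) ℕ.* suc N             ∎

module ChebyshevSums (f : ℤ → ℤ) (a b : ℤ) where

  summand : (ℕ → ℕ → ℤ) → ℕ → ℤ → ℕ → ℤ
  summand c n p j = sgn j * c n j * f (a * + n + b * + j + p)

  csum : (ℕ → ℕ → ℤ) → ℕ → ℤ → ℤ
  csum c n p = sumTo (n / 2) (summand c n p)

  private
    shift₁ : ∀ a b N J p → a * N + b * J + (a + p) ≡ a * (+ 1 + N) + b * J + p
    shift₁ = solve-∀

    shift₂ : ∀ a b N J p → a * N + b * J + (a + a + b + p) ≡ a * (+ 1 + (+ 1 + N)) + b * (+ 1 + J) + p
    shift₂ = solve-∀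

    split : ∀ j {c c₁ d x y z} → c ≡ c₁ + d → y ≡ x → z ≡ x →
            sgn (suc j) * c * f x ≡ sgn (suc j) * c₁ * f y - sgn j * d * f z
    split j {c₁ = c₁} {d} {x} refl refl refl rewrite sgn-suc j = distribute (sgn j) c₁ d (f x)
      where distribute : ∀ s c d u → - s * (c + d) * u ≡ - s * c * u - s * d * u
            distribute = solve-∀

  -- Recurrence of the binomial sums, from Pascal's rule; the sum for n+1 is padded to the
  -- range of n+2 by vanishing terms.
  csum-rec : ∀ n p → csum bcoef (suc (suc n)) p ≡ csum bcoef (suc n) (a + p) - csum bcoef n (a + a + b + p)
  csum-rec n p = begin
      csum bcoef (suc (suc n)) p                                ≡⟨ cong (λ k → sumTo k T₂) (half n) ⟩
      sumTo (suc (n / 2)) T₂                                    ≡⟨ sumTo-peel (n / 2) T₂ T₁ T₀ first rest ⟩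
      sumTo (suc (n / 2)) T₁ - sumTo (n / 2) T₀                 ≡⟨ cong (_- sumTo (n / 2) T₀) (sumTo-pad (suc (n / 2)) T₁ beyond range) ⟩
      csum bcoef (suc n) (a + p) - csum bcoef n (a + a + b + p) ∎
    where
      T₂ = summand bcoef (suc (suc n)) p
      T₁ = summand bcoef (suc n) (a + p)
      T₀ = summand bcoef n (a + a + b + p)
      first : T₂ 0 ≡ T₁ 0
      first = cong (λ z → + 1 * + 1 * f z) (sym (shift₁ a b (+ suc n) (+ 0) p))
      rest : ∀ j → j ≤ n / 2 → T₂ (suc j) ≡ T₁ (suc j) - T₀ j
      rest j _ = split j (bcoef-pascal n j) (shift₁ a b (+ suc n) (+ suc j) p) (shift₂ a b (+ n) (+ j) p)
      beyond : ∀ j → suc n / 2 < j → T₁ j ≡ + 0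
      beyond j lt =
        trans (cong (λ k → sgn j * + k * f x) (binom-vanish (suc n) j lt)) (cong (_* f x) (ℤP.*-zeroʳ (sgn j)))
        where x = a * + suc n + b * + j + (a + p)
      range : suc n / 2 ≤ suc (n / 2)
      range = subst (suc n / 2 ≤_) (half n) (/-monoˡ-≤ 2 (ℕP.n≤1+n (suc n)))

  lucas-rec : ∀ m p → csum lcoef (suc (suc m)) p ≡ csum bcoef (suc (suc m)) p - csum bcoef m (a + a + b + p)
  lucas-rec m p = begin
      csum lcoef (suc (suc m)) p                                ≡⟨ cong (λ k → sumTo k T₂) (half m) ⟩
      sumTo (suc (m / 2)) T₂                                    ≡⟨ sumTo-peel (m / 2) T₂ T₁ T₀ first rest ⟩
      sumTo (suc (m / 2)) T₁ - sumTo (m / 2) T₀                 ≡⟨ cong (λ k → sumTo k T₁ - sumTo (m / 2) T₀) (sym (half m)) ⟩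
      csum bcoef (suc (suc m)) p - csum bcoef m (a + a + b + p) ∎
    where
      T₂ = summand lcoef (suc (suc m)) p
      T₁ = summand bcoef (suc (suc m)) p
      T₀ = summand bcoef m (a + a + b + p)
      first : T₂ 0 ≡ T₁ 0
      first = cong (λ c → + 1 * c * f (a * + suc (suc m) + b * + 0 + p)) (lcoef-first (suc m))
      rest : ∀ j → j ≤ m / 2 → T₂ (suc j) ≡ T₁ (suc j) - T₀ j
      rest j j≤m/2 = split j (lcoef-split m j (ℕP.≤-trans j≤m/2 (m/n≤m m 2))) refl (shift₂ a b (+ m) (+ j) p)

  private
    arg₀ : ∀ a b p → a * + 0 + b * + 0 + p ≡ p
    arg₀ = solve-∀
    arg₁ : ∀ a b p → a * + 1 + b * + 0 + p ≡ a + p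
    arg₁ = solve-∀

  csum-closed-form : (C : ℕ → ℤ → ℤ) → (∀ p → f p ≡ C 0 p) → (∀ p → f (a + p) ≡ C 1 p) →
                     (∀ n p → C (suc (suc n)) p ≡ C (suc n) (a + p) - C n (a + a + b + p)) →
                     ∀ n p → csum bcoef n p ≡ C n p
  csum-closed-form C C₀ C₁ C-rec = go
    where
      go : ∀ n p → csum bcoef n p ≡ C n p
      go zero          p = trans (ℤP.*-identityˡ _) (trans (cong f (arg₀ a b p)) (C₀ p))
      go (suc zero)    p = trans (ℤP.*-identityˡ _) (trans (cong f (arg₁ a b p)) (C₁ p))
      go (suc (suc n)) p = begin
        csum bcoef (suc (suc n)) p                                ≡⟨ csum-rec n p ⟩
        csum bcoef (suc n) (a + p) - csum bcoef n (a + a + b + p) ≡⟨ cong₂ _-_ (go (suc n) (a + p)) (go n (a + a + b + p)) ⟩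
        C (suc n) (a + p) - C n (a + a + b + p)                   ≡⟨ sym (C-rec n p) ⟩
        C (suc (suc n)) p                                         ∎

  lucas-closed-form : (C R : ℕ → ℤ → ℤ) → (∀ n p → csum bcoef n p ≡ C n p) → (∀ p → f (a + p) ≡ R 1 p) →
                      (∀ m p → C (suc (suc m)) p - C m (a + a + b + p) ≡ R (suc (suc m)) p) →
                      ∀ n p → csum lcoef (suc n) p ≡ R (suc n) p
  lucas-closed-form C R sum≡C R₁ R-rec zero    p = trans (ℤP.*-identityˡ _) (trans (cong f (arg₁ a b p)) (R₁ p))
  lucas-closed-form C R sum≡C R₁ R-rec (suc m) p = begin
    csum lcoef (suc (suc m)) p                                ≡⟨ lucas-rec m p ⟩
    csum bcoef (suc (suc m)) p - csum bcoef m (a + a + b + p) ≡⟨ cong₂ _-_ (sum≡C (suc (suc m)) p) (sum≡C m (a + a + b + p)) ⟩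
    C (suc (suc m)) p - C m (a + a + b + p)                   ≡⟨ R-rec m p ⟩
    R (suc (suc m)) p                                         ∎

open ChebyshevSums using (csum; csum-closed-form; lucas-closed-form)

-- Family (a, b) = (1, -3): closed form of the binomial sum (identity 2, with the sign written
-- (-1)^(n+1) so that it also covers n = 0) and of the Lucas sum (identity 1).
closedA : ℕ → ℤ → ℤ
closedA n p = sgn (suc n) * detA p (+ n)

lucasA : ℕ → ℤ → ℤ
lucasA n p = sgn n * (Q (+ n) * P p - P (+ n + p))

-- initial values, by evaluating P(-3) = 0, P(-2) = 1, P(-1) = 0
closedA-0 : ∀ p → P p ≡ closedA 0 p
closedA-0 p = ring (P (p + + 1)) (P p)
  where ring : ∀ u v → v ≡ -[1+ 0 ] * (u * + 0 - v * + 1)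
        ring = solve-∀

closedA-1 : ∀ p → P (+ 1 + p) ≡ closedA 1 p
closedA-1 p = trans (cong P (ℤP.+-comm (+ 1) p)) (ring (P (p + + 1)) (P p))
  where ring : ∀ u v → u ≡ + 1 * (u * + 1 - v * + 0)
        ring = solve-∀

-- the signs (-1)^(n+3), (-1)^(n+2), (-1)^(n+1) turn detA-rec into the sum recurrence
closedA-rec : ∀ n p → closedA (suc (suc n)) p ≡ closedA (suc n) (+ 1 + p) - closedA n (+ 1 + + 1 + - + 3 + p)
closedA-rec n p = trans (cong (sgn (suc n) *_) (detA-rec p (+ n)))
                        (flip (detA (+ 1 + p) (+ 1 + + n)) (detA (- + 1 + p) (+ n)) (sgn-suc n))
  where flip : ∀ {s t} A B → t ≡ - s → t * (- A - B) ≡ s * A - t * B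
        flip {s} A B refl = ring s A B
          where ring : ∀ s A B → - s * (- A - B) ≡ s * A - - s * B
                ring = solve-∀

-- first Lucas value, using Q(1) = 0; then the Lucas combination of closedA, from detA-lucas
lucasA-1 : ∀ p → P (+ 1 + p) ≡ lucasA 1 p
lucasA-1 p = ring (P (+ 1 + p)) (P p)
  where ring : ∀ u v → u ≡ -[1+ 0 ] * (+ 0 * v - u)
        ring = solve-∀

lucasA-rec : ∀ m p → closedA (suc (suc m)) p - closedA m (+ 1 + + 1 + - + 3 + p) ≡ lucasA (suc (suc m)) p
lucasA-rec m p = begin
    t * detA p (+ 2 + + m) - t * detA (- + 1 + p) (+ m) ≡⟨ factor t (detA p (+ 2 + + m)) (detA (- + 1 + p) (+ m)) ⟩
    t * (detA p (+ 2 + + m) - detA (- + 1 + p) (+ m))   ≡⟨ cong (t *_) (detA-lucas p (+ m)) ⟩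
    t * (P (+ 2 + + m + p) - P p * Q (+ 2 + + m))       ≡⟨ flip (P (+ 2 + + m + p)) (P p) (Q (+ 2 + + m)) (sgn-suc m) ⟩
    lucasA (suc (suc m)) p                              ∎
  where
    t = sgn (suc m)
    factor : ∀ t A B → t * A - t * B ≡ t * (A - B)
    factor = solve-∀
    flip : ∀ {s t} D x q → t ≡ - s → t * (D - x * q) ≡ s * (q * x - D)
    flip {s} D x q refl = ring s D x q
      where ring : ∀ s D x q → - s * (D - x * q) ≡ s * (q * x - D)
            ring = solve-∀

-- Family (a, b) = (-4, 8): closed forms of the binomial sum (identity 4) and the Lucas sum
-- (identity 3); both are read through detB at the points x = p + n, y = 2n.
closedB : ℕ → ℤ → ℤ
closedB n p = detB (p + + n) (+ (2 ℕ.* n))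

lucasB : ℕ → ℤ → ℤ
lucasB n p = P (p + + n) * Q (+ (2 ℕ.* n)) - P (p + + (3 ℕ.* n))

-- initial value, by evaluating P(-2) = 1, P(-1) = 0
closedB-0 : ∀ p → P p ≡ closedB 0 p
closedB-0 p = trans (cong P (sym (ℤP.+-identityʳ p))) (ring (P (p + + 0)) (P (p + + 0 - + 1)))
  where ring : ∀ u v → u ≡ u * + 1 - v * + 0
        ring = solve-∀

-- P(p - 4) = P(p + 1) - P(p): both sides solve the recurrence in p and agree at 0, 1, 2
closedB-1 : ∀ p → P (- + 4 + p) ≡ closedB 1 p
closedB-1 = rec-unique (rec-shiftˡ (- + 4) rec-P) (rec-shiftʳ (+ 1) (proj₁ bi-detB (+ 2))) (refl , refl , refl)

-- P(p - 4) = 2 P(p + 1) - P(p + 3), by the same argument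
lucasB-1 : ∀ p → P (- + 4 + p) ≡ lucasB 1 p
lucasB-1 = rec-unique (rec-shiftˡ (- + 4) rec-P)
  (rec-sub (rec-scaleʳ (Q (+ 2)) (rec-shiftʳ (+ 1) rec-P)) (rec-shiftʳ (+ 3) rec-P)) (refl , refl , refl)

module _ (n : ℕ) (p : ℤ) where
  private
    x = p + + n
    y = + (2 ℕ.* n)
    twice : ∀ k n → + (2 ℕ.* (k ℕ.+ n)) ≡ + (2 ℕ.* k) + + (2 ℕ.* n)
    twice k n = cong +_ (ℕP.*-distribˡ-+ 2 k n)
    shift : ∀ c p N → p + (c + N) ≡ c + (p + N)
    shift = solve-∀

  closedB-at-2 : closedB (suc (suc n)) p ≡ detB (+ 2 + x) (+ 4 + y)
  closedB-at-2 = cong₂ detB (shift (+ 2) p (+ n)) (twice 2 n)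

  closedB-at-1 : closedB (suc n) (- + 4 + p) ≡ detB (- + 3 + x) (+ 2 + y)
  closedB-at-1 = cong₂ detB (move p (+ n)) (twice 1 n)
    where move : ∀ p N → - + 4 + p + (+ 1 + N) ≡ - + 3 + (p + N)
          move = solve-∀

  closedB-at-0 : closedB n (+ 0 + p) ≡ detB x y
  closedB-at-0 = cong (λ z → detB (z + + n) y) (ℤP.+-identityˡ p)

  lucasB-at-2 : lucasB (suc (suc n)) p ≡ P (+ 2 + x) * Q (+ 4 + y) - P (+ 6 + y + x)
  lucasB-at-2 = trans (cong₂ (λ u v → P u * Q v - P w) (shift (+ 2) p (+ n)) (twice 2 n))
                      (cong (λ z → P (+ 2 + x) * Q (+ 4 + y) - P z) triple)
    where
      w = p + + (3 ℕ.* suc (suc n))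
      ring : ∀ p N → p + + 3 * (+ 2 + N) ≡ + 6 + + 2 * N + (p + N)
      ring = solve-∀
      triple : w ≡ + 6 + y + x
      triple = trans (cong (λ z → p + z) (ℤP.pos-* 3 (suc (suc n))))
                     (trans (ring p (+ n)) (cong (λ z → + 6 + z + x) (sym (ℤP.pos-* 2 n))))

closedB-rec : ∀ n p → closedB (suc (suc n)) p ≡ closedB (suc n) (- + 4 + p) - closedB n (- + 4 + - + 4 + + 8 + p)
closedB-rec n p = begin
    closedB (suc (suc n)) p                                     ≡⟨ closedB-at-2 n p ⟩
    detB (+ 2 + x) (+ 4 + y)                                    ≡⟨ detB-rec x y ⟩
    detB (- + 3 + x) (+ 2 + y) - detB x y                       ≡⟨ sym (cong₂ _-_ (closedB-at-1 n p) (closedB-at-0 n p)) ⟩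
    closedB (suc n) (- + 4 + p) - closedB n (- + 4 + - + 4 + + 8 + p) ∎
  where x = p + + n
        y = + (2 ℕ.* n)

lucasB-rec : ∀ m p → closedB (suc (suc m)) p - closedB m (- + 4 + - + 4 + + 8 + p) ≡ lucasB (suc (suc m)) p
lucasB-rec m p = begin
    closedB (suc (suc m)) p - closedB m (- + 4 + - + 4 + + 8 + p) ≡⟨ cong₂ _-_ (closedB-at-2 m p) (closedB-at-0 m p) ⟩
    detB (+ 2 + x) (+ 4 + y) - detB x y                         ≡⟨ detB-lucas x y ⟩
    P (+ 2 + x) * Q (+ 4 + y) - P (+ 6 + y + x)                 ≡⟨ sym (lucasB-at-2 m p) ⟩
    lucasB (suc (suc m)) p                                      ∎
  where x = p + + m
        y = + (2 ℕ.* m)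

binomial-sumA : ∀ n p → csum P (+ 1) (- + 3) bcoef n p ≡ closedA n p
binomial-sumA = csum-closed-form P (+ 1) (- + 3) closedA closedA-0 closedA-1 closedA-rec

lucas-sumA : ∀ n p → csum P (+ 1) (- + 3) lcoef (suc n) p ≡ lucasA (suc n) p
lucas-sumA = lucas-closed-form P (+ 1) (- + 3) closedA lucasA binomial-sumA lucasA-1 lucasA-rec

binomial-sumB : ∀ n p → csum P (- + 4) (+ 8) bcoef n p ≡ closedB n p
binomial-sumB = csum-closed-form P (- + 4) (+ 8) closedB closedB-0 closedB-1 closedB-rec

lucas-sumB : ∀ n p → csum P (- + 4) (+ 8) lcoef (suc n) p ≡ lucasB (suc n) p
lucas-sumB = lucas-closed-form P (- + 4) (+ 8) closedB lucasB binomial-sumB lucasB-1 lucasB-rec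

module _ (p : ℤ) (n : ℕ) where
  index-A : ∀ j → p + + n - + (3 ℕ.* j) ≡ + 1 * + n + - + 3 * + j + p
  index-A j = trans (cong (λ z → p + + n - z) (ℤP.pos-* 3 j)) (ring p (+ n) (+ j))
    where ring : ∀ p N J → p + N - + 3 * J ≡ + 1 * N + - + 3 * J + p
          ring = solve-∀

  index-B : ∀ j → p - + (4 ℕ.* n) + + (8 ℕ.* j) ≡ - + 4 * + n + + 8 * + j + p
  index-B j = trans (cong₂ (λ u v → p - u + v) (ℤP.pos-* 4 n) (ℤP.pos-* 8 j)) (ring p (+ n) (+ j))
    where ring : ∀ p N J → p - + 4 * N + + 8 * J ≡ - + 4 * N + + 8 * J + p
          ring = solve-∀

  index-C : ∀ j → p - + (3 ℕ.* n) + + (8 ℕ.* j) ≡ - + 4 * + n + + 8 * + j + (p + + n)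
  index-C j = trans (cong₂ (λ u v → p - u + v) (ℤP.pos-* 3 n) (ℤP.pos-* 8 j)) (ring p (+ n) (+ j))
    where ring : ∀ p N J → p - + 3 * N + + 8 * J ≡ - + 4 * N + + 8 * J + (p + N)
          ring = solve-∀

  index-2n : p + + n + + n ≡ + (2 ℕ.* n) + p
  index-2n = trans (ring p (+ n)) (cong (_+ p) (sym (ℤP.pos-* 2 n)))
    where ring : ∀ p N → p + N + N ≡ + 2 * N + p
          ring = solve-∀

  index-4n : p + + n + + (3 ℕ.* n) ≡ p + + (4 ℕ.* n)
  index-4n = trans (cong (λ z → p + + n + z) (ℤP.pos-* 3 n))
                   (trans (ring p (+ n)) (cong (λ z → p + z) (sym (ℤP.pos-* 4 n))))
    where ring : ∀ p N → p + N + + 3 * N ≡ p + + 4 * N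
          ring = solve-∀

theorem15 : (n : ℕ) → n ≥ 1 → (p : ℤ) →
      (sumTo (n / 2) (λ j → sgn j * lcoef n j * P (p + + n - + (3 ℕ.* j)))
        ≡ sgn n * (Q (+ n) * P p - P (+ n + p)))
    × (sumTo (n / 2) (λ j → sgn j * bcoef n j * P (p + + n - + (3 ℕ.* j)))
        ≡ sgn (n ∸ 1) * (P (p + + 1) * P (+ n - + 3) - P p * P (+ n - + 2)))
    × (sumTo (n / 2) (λ j → sgn j * lcoef n j * P (p - + (4 ℕ.* n) + + (8 ℕ.* j)))
        ≡ P (p + + n) * Q (+ (2 ℕ.* n)) - P (p + + (3 ℕ.* n)))
    × (sumTo (n / 2) (λ j → sgn j * bcoef n j * P (p - + (4 ℕ.* n) + + (8 ℕ.* j)))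
        ≡ P (p + + n) * P (+ (2 ℕ.* n) - + 2) - P (p + + n - + 1) * P (+ (2 ℕ.* n) - + 1))
    × (sumTo (n / 2) (λ j → sgn j * lcoef n j * P (p - + (3 ℕ.* n) + + (8 ℕ.* j)))
        ≡ P (+ (2 ℕ.* n) + p) * Q (+ (2 ℕ.* n)) - P (p + + (4 ℕ.* n)))
    × (sumTo (n / 2) (λ j → sgn j * bcoef n j * P (p - + (3 ℕ.* n) + + (8 ℕ.* j)))
        ≡ P (+ (2 ℕ.* n) + p) * P (+ (2 ℕ.* n) - + 2) - P (+ (2 ℕ.* n) + p - + 1) * P (+ (2 ℕ.* n) - + 1))
theorem15 zero () p
theorem15 n@(suc k) _ p =
    trans (reindex lcoef (index-A p n)) (lucas-sumA k p)
  , trans (reindex bcoef (index-A p n)) (binomial-sumA n p)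
  , trans (reindex lcoef (index-B p n)) (lucas-sumB k p)
  , trans (reindex bcoef (index-B p n)) (binomial-sumB n p)
  , trans (reindex lcoef (index-C p n)) (trans (lucas-sumB k (p + + n))
      (cong₂ (λ u v → P u * Q (+ (2 ℕ.* n)) - P v) (index-2n p n) (index-4n p n)))
  , trans (reindex bcoef (index-C p n)) (trans (binomial-sumB n (p + + n))
      (cong (λ u → detB u (+ (2 ℕ.* n))) (index-2n p n)))
  where
    reindex : ∀ c {u v : ℕ → ℤ} → (∀ j → u j ≡ v j) →
              sumTo (n / 2) (λ j → sgn j * c n j * P (u j)) ≡ sumTo (n / 2) (λ j → sgn j * c n j * P (v j))
    reindex c e = sumTo-cong (n / 2) (λ j _ → cong (λ z → sgn j * c n j * P z) (e j))
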